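{- Let $\sigma_*(x,y,z)$ be a group word with the following two properties: - there exist a group $G$ and $a,b,c\in G$ with $\sigma_*(a,b,c)\ne e_G$; - for every group $G$ and all $a,b,c\in G$, if $e_G\in\{a,b,c\}$ then $\sigma_*(a,b,c)=e_G$. For 6-tuples of variables $\bar x=(x_0,\dots,x_5)$, $\bar y=(y_0,\dots,y_5)$, $\bar z=(z_0,\dots,z_5)$, define $$\varphi_0(\bar x,\bar y):\ y_5^{ -1}x_0y_5=x_2,$$ $$\varphi_1(\bar x,\bar y):\ x_5^{ -1}y_1x_5=y_3\ \wedge\ x_5^{ -1}y_4x_5=y_4,$$ $$\psi(\bar x,\bar y,\bar z):\ \sigma_*(x_0,y_1,z_4)=e\ \wedge\ \sigma_*(x_2,y_3,z_4)\ne e.$$ Then there are no group $G$ and tuples $\bar a_0,\bar a_1,\bar a_2,\bar a_3\in G^6$ such that $$G\models\varphi_0[\bar a_0,\bar a_1]\wedge\varphi_0[\bar a_0,\bar a_2]\wedge\varphi_0[\bar a_0,\bar a_3]\wedge\varphi_1[\bar a_1,\bar a_2]\wedge\varphi_1[\bar a_1,\bar a_3]\wedge\varphi_0[\bar a_2,\bar a_3]\wedge\psi[\bar a_0,\bar a_2,\bar a_3].$$ -}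

module Defs where

open import Level using (Level)
open import Data.Nat using (ℕ)
open import Data.Fin using (Fin; zero; suc)
open import Data.Product using (_×_; ∃; _,_)
open import Data.Sum using (_⊎_)
open import Relation.Nullary using (¬_)
open import Algebra.Bundles using (Group)
open import Data.Fin using (#_)

data Word (n : ℕ) : Set where
  var  : Fin n → Word n
  unit : Word n
  _·_  : Word n → Word n → Word n
  inv  : Word n → Word n

module _ {c ℓ : Level} (G : Group c ℓ) where
  open Group G

  eval : ∀ {n} → Word n → (Fin n → Carrier) → Carrier
  eval (var i)  ρ = ρ i
  eval unit     ρ = ε
  eval (w · v)  ρ = eval w ρ ∙ eval v ρ
  eval (inv w)  ρ = eval w ρ ⁻¹

  apply3 : Word 3 → Carrier → Carrier → Carrier → Carrier
  apply3 σ a b c' = eval σ env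
    where
    env : Fin 3 → Carrier
    env zero = a
    env (suc zero) = b
    env (suc (suc zero)) = c'

  Tuple : Set c
  Tuple = Fin 6 → Carrier

  φ₀ : Tuple → Tuple → Set ℓ
  φ₀ x y = (y (# 5) ⁻¹ ∙ x (# 0)) ∙ y (# 5) ≈ x (# 2)

  φ₁ : Tuple → Tuple → Set ℓ
  φ₁ x y = ((x (# 5) ⁻¹ ∙ y (# 1)) ∙ x (# 5) ≈ y (# 3)) × ((x (# 5) ⁻¹ ∙ y (# 4)) ∙ x (# 5) ≈ y (# 4))

  ψ : Word 3 → Tuple → Tuple → Tuple → Set ℓ
  ψ σ x y z = (apply3 σ (x (# 0)) (y (# 1)) (z (# 4)) ≈ ε) × ¬ (apply3 σ (x (# 2)) (y (# 3)) (z (# 4)) ≈ ε)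

module Submission where

-- Conjugation x ↦ g⁻¹ x g by a fixed element g is a group
-- endomorphism, and the value of a group word commutes with every map that
-- preserves multiplication, unit and inverse.  Hence
--     σ(g⁻¹ a g, g⁻¹ b g, g⁻¹ c g) = g⁻¹ σ(a,b,c) g .
-- Take g = (ā₁)₅.  The hypotheses φ₀[ā₀,ā₁], φ₁[ā₁,ā₂] (first conjunct) and
-- φ₁[ā₁,ā₃] (second conjunct) say that conjugation by g sends the triple
-- ((ā₀)₀, (ā₂)₁, (ā₃)₄) to ((ā₀)₂, (ā₂)₃, (ā₃)₄).  So if σ vanishes on the
-- first triple (first half of ψ) it vanishes on the second, contradicting the
-- second half of ψ.

open import Defs
open import Level using (Level)
open import Data.Product using (_×_; ∃; Σ-syntax; _,_)
open import Data.Sum using (_⊎_)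
open import Relation.Nullary using (¬_)
open import Algebra.Bundles using (Group)
open import Data.Fin using (Fin; zero; suc; #_)

module WordsAndConjugation {c ℓ : Level} (G : Group c ℓ) where
  open Group G
  open import Algebra.Properties.Group G using (⁻¹-anti-homo-∙; ⁻¹-involutive)
  open import Relation.Binary.Reasoning.Setoid setoid

  eval-natural : (f : Carrier → Carrier)
    → (∀ x y → f (x ∙ y) ≈ f x ∙ f y) → f ε ≈ ε → (∀ x → f (x ⁻¹) ≈ f x ⁻¹)
    → ∀ {n} (w : Word n) (ρ : Fin n → Carrier)
    → f (eval G w ρ) ≈ eval G w (λ i → f (ρ i))
  eval-natural f f-∙ f-ε f-⁻¹ (var i) ρ = refl
  eval-natural f f-∙ f-ε f-⁻¹ unit    ρ = f-ε
  eval-natural f f-∙ f-ε f-⁻¹ (w · v) ρ =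
    trans (f-∙ _ _) (∙-cong (eval-natural f f-∙ f-ε f-⁻¹ w ρ) (eval-natural f f-∙ f-ε f-⁻¹ v ρ))
  eval-natural f f-∙ f-ε f-⁻¹ (inv w) ρ =
    trans (f-⁻¹ _) (⁻¹-cong (eval-natural f f-∙ f-ε f-⁻¹ w ρ))

  conj : Carrier → Carrier → Carrier
  conj g x = (g ⁻¹ ∙ x) ∙ g

  conj-∙ : ∀ g x y → conj g (x ∙ y) ≈ conj g x ∙ conj g y
  conj-∙ g x y = begin
    (g ⁻¹ ∙ (x ∙ y)) ∙ g             ≈⟨ ∙-congʳ (sym (assoc _ _ _)) ⟩
    ((g ⁻¹ ∙ x) ∙ y) ∙ g             ≈⟨ assoc _ _ _ ⟩
    (g ⁻¹ ∙ x) ∙ (y ∙ g)             ≈⟨ ∙-congˡ (∙-congʳ (sym (identityˡ y))) ⟩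
    (g ⁻¹ ∙ x) ∙ ((ε ∙ y) ∙ g)       ≈⟨ ∙-congˡ (∙-congʳ (∙-congʳ (sym (inverseʳ g)))) ⟩
    (g ⁻¹ ∙ x) ∙ (((g ∙ g ⁻¹) ∙ y) ∙ g) ≈⟨ ∙-congˡ (∙-congʳ (assoc _ _ _)) ⟩
    (g ⁻¹ ∙ x) ∙ ((g ∙ (g ⁻¹ ∙ y)) ∙ g) ≈⟨ ∙-congˡ (assoc _ _ _) ⟩
    (g ⁻¹ ∙ x) ∙ (g ∙ ((g ⁻¹ ∙ y) ∙ g)) ≈⟨ sym (assoc _ _ _) ⟩
    ((g ⁻¹ ∙ x) ∙ g) ∙ ((g ⁻¹ ∙ y) ∙ g) ∎

  conj-ε : ∀ g → conj g ε ≈ ε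
  conj-ε g = trans (∙-congʳ (identityʳ (g ⁻¹))) (inverseˡ g)

  conj-⁻¹ : ∀ g x → conj g (x ⁻¹) ≈ conj g x ⁻¹
  conj-⁻¹ g x = begin
    (g ⁻¹ ∙ x ⁻¹) ∙ g         ≈⟨ assoc _ _ _ ⟩
    g ⁻¹ ∙ (x ⁻¹ ∙ g)         ≈⟨ ∙-congˡ (∙-congˡ (sym (⁻¹-involutive g))) ⟩
    g ⁻¹ ∙ (x ⁻¹ ∙ g ⁻¹ ⁻¹)   ≈⟨ ∙-congˡ (sym (⁻¹-anti-homo-∙ _ _)) ⟩
    g ⁻¹ ∙ (g ⁻¹ ∙ x) ⁻¹      ≈⟨ sym (⁻¹-anti-homo-∙ _ _) ⟩
    ((g ⁻¹ ∙ x) ∙ g) ⁻¹       ∎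

  eval-conj : ∀ {n} g (w : Word n) (ρ ρ' : Fin n → Carrier)
    → (∀ i → conj g (ρ i) ≈ ρ' i) → eval G w ρ' ≈ conj g (eval G w ρ)
  eval-conj g w ρ ρ' ρ'≈ = begin
    eval G w ρ'                        ≈⟨ eval-cong w ρ'≈ ⟩
    eval G w (λ i → conj g (ρ i))      ≈⟨ sym (eval-natural (conj g) (conj-∙ g) (conj-ε g) (conj-⁻¹ g) w ρ) ⟩
    conj g (eval G w ρ)                ∎
    where
    eval-cong : ∀ {n} (w : Word n) {ρ₁ ρ₂ : Fin n → Carrier}
      → (∀ i → ρ₂ i ≈ ρ₁ i) → eval G w ρ₁ ≈ eval G w ρ₂
    eval-cong (var i) ρ≈ = sym (ρ≈ i)
    eval-cong unit    ρ≈ = refl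
    eval-cong (w · v) ρ≈ = ∙-cong (eval-cong w ρ≈) (eval-cong v ρ≈)
    eval-cong (inv w) ρ≈ = ⁻¹-cong (eval-cong w ρ≈)

  apply3-conj-vanishes : ∀ σ g a b c' a' b' c''
    → conj g a ≈ a' → conj g b ≈ b' → conj g c' ≈ c''
    → apply3 G σ a b c' ≈ ε → apply3 G σ a' b' c'' ≈ ε
  apply3-conj-vanishes σ g a b c' a' b' c'' a≈ b≈ c≈ vanishes = begin
    apply3 G σ a' b' c''         ≈⟨ eval-conj g σ _ _ conjugates ⟩
    conj g (apply3 G σ a b c')   ≈⟨ ∙-congʳ (∙-congˡ vanishes) ⟩
    conj g ε                     ≈⟨ conj-ε g ⟩
    ε                            ∎
    where
    -- The environment of apply3 is a local definition, so its type is left to unification.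
    conjugates : ∀ (i : Fin 3) → _
    conjugates zero             = a≈
    conjugates (suc zero)       = b≈
    conjugates (suc (suc zero)) = c≈

claim2p5 : {c₀ ℓ₀ : Level} (σ : Word 3)
    → (Σ[ G ∈ Group c₀ ℓ₀ ] ∃ λ a → ∃ λ b → ∃ λ c → ¬ (Group._≈_ G (apply3 G σ a b c) (Group.ε G)))
    → (∀ {c' ℓ'} (G : Group c' ℓ') (a b c : Group.Carrier G)
    → (Group._≈_ G a (Group.ε G) ⊎ Group._≈_ G b (Group.ε G) ⊎ Group._≈_ G c (Group.ε G))
    → Group._≈_ G (apply3 G σ a b c) (Group.ε G))
    → ∀ {c ℓ} (G : Group c ℓ) → ¬ (Σ[ a₀ ∈ Tuple G ] Σ[ a₁ ∈ Tuple G ] Σ[ a₂ ∈ Tuple G ] Σ[ a₃ ∈ Tuple G ]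
    (φ₀ G a₀ a₁ × φ₀ G a₀ a₂ × φ₀ G a₀ a₃ × φ₁ G a₁ a₂ × φ₁ G a₁ a₃ × φ₀ G a₂ a₃ × ψ G σ a₀ a₂ a₃))
claim2p5 σ _ _ G
  (a₀ , a₁ , a₂ , a₃ , φ₀[a₀,a₁] , _ , _ , (φ₁[a₁,a₂]ˡ , _) , (_ , φ₁[a₁,a₃]ʳ) , _ , (vanishes , ¬vanishes)) =
  ¬vanishes (apply3-conj-vanishes σ (a₁ (# 5)) _ _ _ _ _ _
               φ₀[a₀,a₁] φ₁[a₁,a₂]ˡ φ₁[a₁,a₃]ʳ vanishes)
  where open WordsAndConjugation G
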